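{- Let $n_1\le n_2$ be integers and let $\phi:\mathbb{B}^{n_2}\to\mathbb{B}$ be a Boolean function given as a propositional formula. Define the Boolean network $f:\mathbb{B}^{n_2+2}\to\mathbb{B}^{n_2+2}$ by $f_j(\mathbf{x})=(\mathbf{x}_j\wedge\neg\mathbf{x}_{n_2+1})\vee\mathbf{x}_{n_2+2}$ for $j\in[1,n_1]$; $f_j(\mathbf{x})=\neg\mathbf{x}_j$ for $j\in[n_1+1,n_2]$; $f_{n_2+1}(\mathbf{x})=\phi(\mathbf{x}_{[1,n_2]})\wedge\neg\mathbf{x}_{n_2+2}$; $f_{n_2+2}(\mathbf{x})=\mathbf{x}_{n_2+1}\wedge\neg\mathbf{x}_{n_2+2}$. Then the quantified Boolean formula $\forall\mathbf{y}_{[1,n_1]}\,\exists\mathbf{y}_{[n_1+1,n_2]}\,\phi(\mathbf{y})$ is true if and only if $*^{n_2+2}$ is the unique trap space of $f$.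
   Context: $\mathbb{B}=\{0,1\}$, $[a,b]=\{a,\dots,b\}$ (empty if $a>b$), and $\mathbf{x}_{[a,b]}$ denotes the subvector $(\mathbf{x}_a,\dots,\mathbf{x}_b)$. A Boolean network of dimension $m$ is a map $f:\mathbb{B}^m\to\mathbb{B}^m$ with local functions $f_i$. A sub-hypercube is a vector $\mathbf{h}\in\{0,1,*\}^m$ with vertex set $v(\mathbf{h})=\{\mathbf{x}\in\mathbb{B}^m:\forall i,\ \mathbf{h}_i\neq *\Rightarrow\mathbf{x}_i=\mathbf{h}_i\}$. A trap space of $f$ is a sub-hypercube $\mathbf{h}$ with $f(\mathbf{x})\in v(\mathbf{h})$ for all $\mathbf{x}\in v(\mathbf{h})$. $*^{m}$ denotes the sub-hypercube whose entries are all $*$ (the whole space $\mathbb{B}^m$). -}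

module Defs where

open import Data.Bool using (Bool; true; false; _∧_; _∨_; not)
import Data.Nat
open import Data.Nat using (ℕ; _+_; _<_; _≤_; _<ᵇ_)
import Data.Fin
open import Data.Fin using (Fin; toℕ; _↑ˡ_; _↑ʳ_)
open import Data.Vec using (Vec; lookup; tabulate)
open import Data.Maybe using (Maybe; just; nothing)
open import Data.Product using (Σ; ∃; _×_)
open import Relation.Binary.PropositionalEquality using (_≡_)

data Formula (n : ℕ) : Set where
  var  : Fin n → Formula n
  tt   : Formula n
  ff   : Formula n
  ¬f_  : Formula n → Formula n
  _∧f_ : Formula n → Formula n → Formula n
  _∨f_ : Formula n → Formula n → Formula n

⟦_⟧ : ∀ {n} → Formula n → Vec Bool n → Bool
⟦ var i ⟧ x = lookup x i
⟦ tt ⟧ x = true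
⟦ ff ⟧ x = false
⟦ ¬f φ ⟧ x = not (⟦ φ ⟧ x)
⟦ φ ∧f ψ ⟧ x = ⟦ φ ⟧ x ∧ ⟦ ψ ⟧ x
⟦ φ ∨f ψ ⟧ x = ⟦ φ ⟧ x ∨ ⟦ ψ ⟧ x

BN : ℕ → Set
BN m = Vec Bool m → Vec Bool m

-- Sub-hypercubes: entries just b = fixed value b, nothing = *
SubHypercube : ℕ → Set
SubHypercube m = Vec (Maybe Bool) m

_∈v_ : ∀ {m} → Vec Bool m → SubHypercube m → Set
_∈v_ {m} x h = ∀ (i : Fin m) (b : Bool) → lookup h i ≡ just b → lookup x i ≡ b

IsTrapSpace : ∀ {m} → BN m → SubHypercube m → Set
IsTrapSpace f h = ∀ x → x ∈v h → f x ∈v h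

allStar : (m : ℕ) → SubHypercube m
allStar m = tabulate (λ _ → nothing)

UniqueTrapSpace : ∀ {m} → BN m → SubHypercube m → Set
UniqueTrapSpace f h = IsTrapSpace f h × (∀ h' → IsTrapSpace f h' → h' ≡ h)

-- The network of the statement, with 0-based indices:
-- paper index j ∈ [1,n₁]   ↔ toℕ i < n₁
-- paper index j ∈ [n₁+1,n₂] ↔ n₁ ≤ toℕ i < n₂
-- paper index n₂+1 ↔ 0-based n₂, paper index n₂+2 ↔ 0-based n₂+1
netF : (n₁ n₂ : ℕ) → Formula n₂ → BN (n₂ + 2)
netF n₁ n₂ φ x = tabulate go
  where
    xs : Vec Bool n₂
    xs = tabulate (λ i → lookup x (i ↑ˡ 2))
    a : Bool
    a = lookup x (n₂ ↑ʳ Fin.zero)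
    c : Bool
    c = lookup x (n₂ ↑ʳ Fin.suc Fin.zero)
    go : Fin (n₂ + 2) → Bool
    go i with toℕ i <ᵇ n₁ | toℕ i <ᵇ n₂ | toℕ i Data.Nat.≡ᵇ n₂
    ... | true  | _     | _     = (lookup x i ∧ not a) ∨ c
    ... | false | true  | _     = not (lookup x i)
    ... | false | false | true  = ⟦ φ ⟧ xs ∧ not c
    ... | false | false | false = a ∧ not c

-- Write a state as ⟨ u ∣ e ∣ a ∣ c ⟩: the universally quantified block, the existentially
-- quantified block, and the coordinates n₂+1, n₂+2. Suppose every u extends to a model u ++ e
-- of φ, and let h be a trap space. The coordinates of e are negated at every step, so they are
-- free in h and can be chosen at will. From any state the pair (a , c) reaches (0 , 0) within two
-- steps; choosing e with φ (u ++ e) true it then moves to (1 , 0) and to (1 , 1), the last step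
-- also resetting u to 0…0. The state ⟨ 0…0 ∣ e ∣ 1 ∣ 1 ⟩ is mapped to its complement, so h fixes
-- no coordinate. Conversely, if some y₁ has no extension to a model, ⟨ y₁ ∣ *…* ∣ 0 ∣ 0 ⟩ is a
-- trap space different from *^(n₂+2).
module Submission where

open import Defs
open import Data.Bool using (Bool; true; false; _∧_; _∨_; not; _≟_)
open import Data.Bool.Properties using (T-≡; ¬-not; not-¬; ∧-zeroʳ; ∧-identityʳ; ∨-identityʳ)
open import Data.Empty using (⊥-elim)
open import Data.Fin using (Fin; toℕ; _↑ˡ_; _↑ʳ_)
open import Data.Fin.Properties using (toℕ-↑ˡ; toℕ-↑ʳ; toℕ<n)
open import Data.Maybe using (Maybe; just; nothing; fromMaybe)
import Data.Nat
open import Data.Nat using (ℕ; zero; suc; _+_; _∸_; _<_; _≤_; _<ᵇ_; _≡ᵇ_)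
open import Data.Nat.Properties
  using (<⇒<ᵇ; <ᵇ⇒<; ≡⇒≡ᵇ; ≡ᵇ⇒≡; ≤⇒≯; <⇒≢; ≤-refl; ≤-trans; n≤1+n; n<1+n; m≤m+n; +-monoʳ-<; +-identityʳ; +-comm; m+[n∸m]≡n)
open import Data.Product using (∃; _×_; _,_; proj₁; proj₂)
open import Data.Sum using (inj₁; inj₂)
open import Data.Vec using (Vec; []; _∷_; _++_; lookup; tabulate; map; replicate; splitAt)
open import Data.Vec.Properties
  using (lookup∘tabulate; tabulate∘lookup; tabulate-cong; lookup-++ˡ; lookup-++ʳ; lookup-map; map-++; map-replicate; map-cong; map-const; map-id)
open import Data.Vec.Relation.Binary.Pointwise.Inductive using (Pointwise; _∷_; []; ++⁺; ++⁻; Pointwise-≡⇒≡)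
open import Data.Vec.Relation.Binary.Pointwise.Extensional as Extensional using (ext; extensional⇒inductive; inductive⇒extensional)
open import Function.Base using (_∘_)
open import Function.Bundles using (_⇔_; mk⇔; Equivalence)
open import Relation.Binary.PropositionalEquality using (_≡_; _≢_; refl; sym; trans; cong; cong₂; subst; module ≡-Reasoning)
open import Relation.Nullary using (Dec; yes; no)
open import Relation.Nullary.Decidable using (map′; _⊎-dec_)

open Equivalence using (to; from)

private variable
  A B : Set

<⇒<ᵇ≡true : ∀ {m n} → m < n → (m <ᵇ n) ≡ true
<⇒<ᵇ≡true m<n = to T-≡ (<⇒<ᵇ m<n)

≤⇒<ᵇ≡false : ∀ {m n} → n ≤ m → (m <ᵇ n) ≡ false
≤⇒<ᵇ≡false {m} {n} n≤m = ¬-not (λ m<ᵇn → ≤⇒≯ n≤m (<ᵇ⇒< m n (from T-≡ m<ᵇn)))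

≡⇒≡ᵇ≡true : ∀ {m n} → m ≡ n → (m ≡ᵇ n) ≡ true
≡⇒≡ᵇ≡true {m} {n} m≡n = to T-≡ (≡⇒≡ᵇ m n m≡n)

≢⇒≡ᵇ≡false : ∀ {m n} → m ≢ n → (m ≡ᵇ n) ≡ false
≢⇒≡ᵇ≡false {m} {n} m≢n = ¬-not (λ m≡ᵇn → m≢n (≡ᵇ⇒≡ m n (from T-≡ m≡ᵇn)))

lookup-≡tabulate : ∀ {n} {v : Vec A n} {f : Fin n → A} → v ≡ tabulate f → ∀ i → lookup v i ≡ f i
lookup-≡tabulate refl i = lookup∘tabulate _ i

lookup-ext : ∀ {n} {x y : Vec A n} → (∀ i → lookup x i ≡ lookup y i) → x ≡ y
lookup-ext x≗y = Pointwise-≡⇒≡ (extensional⇒inductive (ext x≗y))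

module _ {n₁ n₂ : ℕ} (φ : Formula n₂) (x : Vec Bool (n₂ + 2)) where

  private
    xₐ = lookup x (n₂ ↑ʳ Fin.zero)
    x꜀ = lookup x (n₂ ↑ʳ Fin.suc Fin.zero)
    -- netF is a tabulation of a where-bound function that cannot be named here; this exposes
    -- its with-clauses to rewriting by the values of the index comparisons.
    unfold = lookup-≡tabulate {v = netF n₁ n₂ φ x} refl

  netF-lookup-<n₁ : ∀ {i} → toℕ i < n₁ → lookup (netF n₁ n₂ φ x) i ≡ (lookup x i ∧ not xₐ) ∨ x꜀
  netF-lookup-<n₁ {i} i<n₁ rewrite unfold i | <⇒<ᵇ≡true i<n₁ = refl

  netF-lookup-<n₂ : ∀ {i} → n₁ ≤ toℕ i → toℕ i < n₂ → lookup (netF n₁ n₂ φ x) i ≡ not (lookup x i)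
  netF-lookup-<n₂ {i} n₁≤i i<n₂ rewrite unfold i | ≤⇒<ᵇ≡false n₁≤i | <⇒<ᵇ≡true i<n₂ = refl

  netF-lookup-n₂ : n₁ ≤ n₂ →
                   lookup (netF n₁ n₂ φ x) (n₂ ↑ʳ Fin.zero) ≡ ⟦ φ ⟧ (tabulate (λ i → lookup x (i ↑ˡ 2))) ∧ not x꜀
  netF-lookup-n₂ n₁≤n₂
    rewrite unfold (n₂ ↑ʳ Fin.zero) | toℕ-↑ʳ n₂ (Fin.zero {1}) | +-identityʳ n₂
          | ≤⇒<ᵇ≡false n₁≤n₂ | ≤⇒<ᵇ≡false (≤-refl {n₂}) | ≡⇒≡ᵇ≡true {n₂} refl = refl

  netF-lookup-1+n₂ : n₁ ≤ n₂ → lookup (netF n₁ n₂ φ x) (n₂ ↑ʳ Fin.suc Fin.zero) ≡ xₐ ∧ not x꜀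
  netF-lookup-1+n₂ n₁≤n₂
    rewrite unfold (n₂ ↑ʳ Fin.suc Fin.zero) | toℕ-↑ʳ n₂ (Fin.suc (Fin.zero {0})) | +-comm n₂ 1
          | ≤⇒<ᵇ≡false (≤-trans n₁≤n₂ (n≤1+n n₂)) | ≤⇒<ᵇ≡false (n≤1+n n₂) | ≢⇒≡ᵇ≡false (<⇒≢ (n<1+n n₂) ∘ sym) = refl

infix 4 _∈₁_ _∈ₚ_

_∈₁_ : Bool → Maybe Bool → Set
b ∈₁ c = ∀ b′ → c ≡ just b′ → b ≡ b′

_∈ₚ_ : ∀ {m} → Vec Bool m → SubHypercube m → Set
_∈ₚ_ = Pointwise _∈₁_

∈v⇔∈ₚ : ∀ {m} {x : Vec Bool m} {h} → x ∈v h ⇔ x ∈ₚ h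
∈v⇔∈ₚ = mk⇔ (λ x∈h → extensional⇒inductive (ext x∈h))
            (λ x∈h → Extensional.Pointwise.app (inductive⇒extensional x∈h))

isTrapSpace⇔ : ∀ {m} {f : BN m} {h} → IsTrapSpace f h ⇔ (∀ x → x ∈ₚ h → f x ∈ₚ h)
isTrapSpace⇔ = mk⇔ (λ trap x → to ∈v⇔∈ₚ ∘ trap x ∘ from ∈v⇔∈ₚ)
                   (λ trap x → from ∈v⇔∈ₚ ∘ trap x ∘ to ∈v⇔∈ₚ)

∈₁-just : ∀ {b b′} → b ≡ b′ → b ∈₁ just b′
∈₁-just refl _ refl = refl

∈ₚ-allStar : ∀ {m} (x : Vec Bool m) → x ∈ₚ allStar m
∈ₚ-allStar []      = []
∈ₚ-allStar (_ ∷ x) = (λ _ ()) ∷ ∈ₚ-allStar x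

allStar-isTrapSpace : ∀ {m} (f : BN m) → IsTrapSpace f (allStar m)
allStar-isTrapSpace f = from isTrapSpace⇔ (λ x _ → ∈ₚ-allStar (f x))

fromMaybe-∈ₚ : ∀ {m} (h : SubHypercube m) → map (fromMaybe false) h ∈ₚ h
fromMaybe-∈ₚ []            = []
fromMaybe-∈ₚ (nothing ∷ h) = (λ _ ()) ∷ fromMaybe-∈ₚ h
fromMaybe-∈ₚ (just b ∷ h)  = ∈₁-just refl ∷ fromMaybe-∈ₚ h

∈ₚ-map-just : ∀ {m} (x : Vec Bool m) → x ∈ₚ map just x
∈ₚ-map-just []      = []
∈ₚ-map-just (_ ∷ x) = ∈₁-just refl ∷ ∈ₚ-map-just x

∈ₚ-map-just⁻ : ∀ {m} {x y : Vec Bool m} → x ∈ₚ map just y → x ≡ y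
∈ₚ-map-just⁻ {y = []}    []          = refl
∈ₚ-map-just⁻ {y = _ ∷ _} (b∈ ∷ x∈)  = cong₂ _∷_ (b∈ _ refl) (∈ₚ-map-just⁻ x∈)

∈ₚ-complement⇒allStar : ∀ {m} {x : Vec Bool m} {h} → x ∈ₚ h → map not x ∈ₚ h → h ≡ allStar m
∈ₚ-complement⇒allStar {h = []}          []       []       = refl
∈ₚ-complement⇒allStar {h = nothing ∷ _} (_ ∷ x∈) (_ ∷ x̄∈) = cong (nothing ∷_) (∈ₚ-complement⇒allStar x∈ x̄∈)
∈ₚ-complement⇒allStar {h = just b ∷ _}  (b∈ ∷ _) (b̄∈ ∷ _) = ⊥-elim (not-¬ refl (trans (b∈ b refl) (sym (b̄∈ b refl))))

∃-Vec-Bool? : ∀ {n} {P : Vec Bool n → Set} → (∀ y → Dec (P y)) → Dec (∃ P)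
∃-Vec-Bool? {zero}  P? = map′ ([] ,_) (λ { ([] , p) → p }) (P? [])
∃-Vec-Bool? {suc n} P? =
  map′ (λ { (inj₁ (y , p)) → true ∷ y , p ; (inj₂ (y , p)) → false ∷ y , p })
       (λ { (true ∷ y , p) → inj₁ (y , p) ; (false ∷ y , p) → inj₂ (y , p) })
       (∃-Vec-Bool? (P? ∘ (true ∷_)) ⊎-dec ∃-Vec-Bool? (P? ∘ (false ∷_)))

module _ {n₁ k : ℕ} where

  -- Opaque, so that the four blocks of a state can be recovered by unification.
  opaque
    ⟨_∣_∣_∣_⟩ : Vec A n₁ → Vec A k → A → A → Vec A (n₁ + k + 2)
    ⟨ u ∣ e ∣ a ∣ c ⟩ = (u ++ e) ++ a ∷ c ∷ []

  data Blocks {A : Set} : Vec A (n₁ + k + 2) → Set where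
    ⟨_∣_∣_∣_⟩ᵇ : ∀ u e a c → Blocks ⟨ u ∣ e ∣ a ∣ c ⟩

  opaque
    unfolding ⟨_∣_∣_∣_⟩

    blocks : (v : Vec A (n₁ + k + 2)) → Blocks v
    blocks v with splitAt (n₁ + k) v
    ... | w , a ∷ c ∷ [] , refl with splitAt n₁ w
    ...   | u , e , refl = ⟨ u ∣ e ∣ a ∣ c ⟩ᵇ

    lookup-⟨⟩-u : ∀ (u : Vec A n₁) (e : Vec A k) a c j → lookup ⟨ u ∣ e ∣ a ∣ c ⟩ ((j ↑ˡ k) ↑ˡ 2) ≡ lookup u j
    lookup-⟨⟩-u u e a c j = trans (lookup-++ˡ (u ++ e) _ (j ↑ˡ k)) (lookup-++ˡ u e j)

    lookup-⟨⟩-e : ∀ (u : Vec A n₁) (e : Vec A k) a c j → lookup ⟨ u ∣ e ∣ a ∣ c ⟩ ((n₁ ↑ʳ j) ↑ˡ 2) ≡ lookup e j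
    lookup-⟨⟩-e u e a c j = trans (lookup-++ˡ (u ++ e) _ (n₁ ↑ʳ j)) (lookup-++ʳ u e j)

    lookup-⟨⟩-a : ∀ (u : Vec A n₁) (e : Vec A k) a c → lookup ⟨ u ∣ e ∣ a ∣ c ⟩ ((n₁ + k) ↑ʳ Fin.zero) ≡ a
    lookup-⟨⟩-a u e a c = lookup-++ʳ (u ++ e) _ Fin.zero

    lookup-⟨⟩-c : ∀ (u : Vec A n₁) (e : Vec A k) a c → lookup ⟨ u ∣ e ∣ a ∣ c ⟩ ((n₁ + k) ↑ʳ Fin.suc Fin.zero) ≡ c
    lookup-⟨⟩-c u e a c = lookup-++ʳ (u ++ e) _ (Fin.suc Fin.zero)

    tabulate-⟨⟩ : ∀ (u : Vec A n₁) (e : Vec A k) a c → tabulate (λ i → lookup ⟨ u ∣ e ∣ a ∣ c ⟩ (i ↑ˡ 2)) ≡ u ++ e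
    tabulate-⟨⟩ u e a c = trans (tabulate-cong (lookup-++ˡ (u ++ e) _)) (tabulate∘lookup (u ++ e))

    map-⟨⟩ : ∀ (f : A → B) (u : Vec A n₁) (e : Vec A k) a c → map f ⟨ u ∣ e ∣ a ∣ c ⟩ ≡ ⟨ map f u ∣ map f e ∣ f a ∣ f c ⟩
    map-⟨⟩ f u e a c = trans (map-++ f (u ++ e) _) (cong (_++ _) (map-++ f u e))

    ∈ₚ-⟨⟩⁺ : ∀ {u e a c hu he ha hc} → u ∈ₚ hu → e ∈ₚ he → a ∈₁ ha → c ∈₁ hc →
             ⟨ u ∣ e ∣ a ∣ c ⟩ ∈ₚ ⟨ hu ∣ he ∣ ha ∣ hc ⟩
    ∈ₚ-⟨⟩⁺ u∈ e∈ a∈ c∈ = ++⁺ (++⁺ u∈ e∈) (a∈ ∷ c∈ ∷ [])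

    ∈ₚ-⟨⟩⁻ : ∀ {u e a c hu he ha hc} → ⟨ u ∣ e ∣ a ∣ c ⟩ ∈ₚ ⟨ hu ∣ he ∣ ha ∣ hc ⟩ →
             u ∈ₚ hu × e ∈ₚ he × a ∈₁ ha × c ∈₁ hc
    ∈ₚ-⟨⟩⁻ {u} {e} {hu = hu} {he} x∈h with ++⁻ (u ++ e) (hu ++ he) x∈h
    ... | ue∈ , a∈ ∷ c∈ ∷ [] with ++⁻ u hu ue∈
    ...   | u∈ , e∈ = u∈ , e∈ , a∈ , c∈

  lookup⇒≡⟨⟩ : ∀ {v : Vec A (n₁ + k + 2)} {u e a c} →
               (∀ j → lookup v ((j ↑ˡ k) ↑ˡ 2) ≡ lookup u j) →
               (∀ j → lookup v ((n₁ ↑ʳ j) ↑ˡ 2) ≡ lookup e j) →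
               lookup v ((n₁ + k) ↑ʳ Fin.zero) ≡ a →
               lookup v ((n₁ + k) ↑ʳ Fin.suc Fin.zero) ≡ c →
               v ≡ ⟨ u ∣ e ∣ a ∣ c ⟩
  lookup⇒≡⟨⟩ {v = v} {u} {e} vᵤ vₑ vₐ v꜀ with blocks v
  ... | ⟨ u′ ∣ e′ ∣ a′ ∣ c′ ⟩ᵇ =
    cong-⟨⟩ (lookup-ext λ j → trans (sym (lookup-⟨⟩-u u′ e′ a′ c′ j)) (vᵤ j))
            (lookup-ext λ j → trans (sym (lookup-⟨⟩-e u′ e′ a′ c′ j)) (vₑ j))
            (trans (sym (lookup-⟨⟩-a u′ e′ a′ c′)) vₐ)
            (trans (sym (lookup-⟨⟩-c u′ e′ a′ c′)) v꜀)
    where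
    cong-⟨⟩ : ∀ {u u′ e e′ a a′ c c′} → u ≡ u′ → e ≡ e′ → a ≡ a′ → c ≡ c′ →
              ⟨ u ∣ e ∣ a ∣ c ⟩ ≡ ⟨ u′ ∣ e′ ∣ a′ ∣ c′ ⟩
    cong-⟨⟩ refl refl refl refl = refl

module _ {n₁ k : ℕ} (φ : Formula (n₁ + k)) where

  private variable
    u u′ : Vec Bool n₁
    e    : Vec Bool k
    a a′ c c′ : Bool

  ForallExists : Set
  ForallExists = (y₁ : Vec Bool n₁) → ∃ λ (y₂ : Vec Bool k) → ⟦ φ ⟧ (y₁ ++ y₂) ≡ true

  netF-⟨⟩ : ∀ u e a c → netF n₁ (n₁ + k) φ ⟨ u ∣ e ∣ a ∣ c ⟩ ≡
            ⟨ map (λ b → (b ∧ not a) ∨ c) u ∣ map not e ∣ ⟦ φ ⟧ (u ++ e) ∧ not c ∣ a ∧ not c ⟩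
  netF-⟨⟩ u e a c = lookup⇒≡⟨⟩ {u = map (λ b → (b ∧ not a) ∨ c) u} {e = map not e} fᵤ fₑ fₐ f꜀
    where
    x = ⟨ u ∣ e ∣ a ∣ c ⟩
    n₁≤n₂ = m≤m+n n₁ k

    toℕ-u : ∀ j → toℕ ((j ↑ˡ k) ↑ˡ 2) ≡ toℕ j
    toℕ-u j = trans (toℕ-↑ˡ (j ↑ˡ k) 2) (toℕ-↑ˡ j k)

    toℕ-e : ∀ j → toℕ ((n₁ ↑ʳ j) ↑ˡ 2) ≡ n₁ + toℕ j
    toℕ-e j = trans (toℕ-↑ˡ (n₁ ↑ʳ j) 2) (toℕ-↑ʳ n₁ j)

    fᵤ : ∀ j → lookup (netF n₁ (n₁ + k) φ x) ((j ↑ˡ k) ↑ˡ 2) ≡ lookup (map (λ b → (b ∧ not a) ∨ c) u) j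
    fᵤ j rewrite netF-lookup-<n₁ φ x (subst (_< n₁) (sym (toℕ-u j)) (toℕ<n j))
               | lookup-⟨⟩-u u e a c j | lookup-⟨⟩-a u e a c | lookup-⟨⟩-c u e a c = sym (lookup-map j _ u)

    fₑ : ∀ j → lookup (netF n₁ (n₁ + k) φ x) ((n₁ ↑ʳ j) ↑ˡ 2) ≡ lookup (map not e) j
    fₑ j rewrite netF-lookup-<n₂ φ x (subst (n₁ ≤_) (sym (toℕ-e j)) (m≤m+n n₁ (toℕ j)))
                                    (subst (_< n₁ + k) (sym (toℕ-e j)) (+-monoʳ-< n₁ (toℕ<n j)))
               | lookup-⟨⟩-e u e a c j = sym (lookup-map j not e)

    fₐ : lookup (netF n₁ (n₁ + k) φ x) ((n₁ + k) ↑ʳ Fin.zero) ≡ ⟦ φ ⟧ (u ++ e) ∧ not c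
    fₐ rewrite netF-lookup-n₂ φ x n₁≤n₂ | tabulate-⟨⟩ u e a c | lookup-⟨⟩-c u e a c = refl

    f꜀ : lookup (netF n₁ (n₁ + k) φ x) ((n₁ + k) ↑ʳ Fin.suc Fin.zero) ≡ a ∧ not c
    f꜀ rewrite netF-lookup-1+n₂ φ x n₁≤n₂ | lookup-⟨⟩-a u e a c | lookup-⟨⟩-c u e a c = refl

  netF-flips : ∀ e → netF n₁ (n₁ + k) φ ⟨ replicate n₁ false ∣ e ∣ true ∣ true ⟩ ≡
                     map not ⟨ replicate n₁ false ∣ e ∣ true ∣ true ⟩
  netF-flips e = begin
    netF n₁ (n₁ + k) φ ⟨ replicate n₁ false ∣ e ∣ true ∣ true ⟩
      ≡⟨ netF-⟨⟩ (replicate n₁ false) e true true ⟩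
    ⟨ map (λ b → (b ∧ false) ∨ true) (replicate n₁ false) ∣ map not e ∣ ⟦ φ ⟧ (replicate n₁ false ++ e) ∧ false ∣ false ⟩
      ≡⟨ cong₂ (λ u a → ⟨ u ∣ map not e ∣ a ∣ false ⟩)
               (trans (map-replicate _ false n₁) (sym (map-replicate not false n₁))) (∧-zeroʳ _) ⟩
    ⟨ map not (replicate n₁ false) ∣ map not e ∣ false ∣ false ⟩
      ≡⟨ map-⟨⟩ not (replicate n₁ false) e true true ⟨
    map not ⟨ replicate n₁ false ∣ e ∣ true ∣ true ⟩ ∎
    where open ≡-Reasoning

  module Solvable (solvable : ForallExists) {hu : SubHypercube n₁} {he : SubHypercube k} {ha hc : Maybe Bool}
                  (trap : ∀ x → x ∈ₚ ⟨ hu ∣ he ∣ ha ∣ hc ⟩ → netF n₁ (n₁ + k) φ x ∈ₚ ⟨ hu ∣ he ∣ ha ∣ hc ⟩)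
                  where

    private
      h : SubHypercube (n₁ + k + 2)
      h = ⟨ hu ∣ he ∣ ha ∣ hc ⟩

    step : ⟨ u ∣ e ∣ a ∣ c ⟩ ∈ₚ h →
           ⟨ map (λ b → (b ∧ not a) ∨ c) u ∣ map not e ∣ ⟦ φ ⟧ (u ++ e) ∧ not c ∣ a ∧ not c ⟩ ∈ₚ h
    step {u} {e} {a} {c} x∈h = subst (_∈ₚ h) (netF-⟨⟩ u e a c) (trap _ x∈h)

    some-point : ⟨ map (fromMaybe false) hu ∣ map (fromMaybe false) he ∣ fromMaybe false ha ∣ fromMaybe false hc ⟩ ∈ₚ h
    some-point = subst (_∈ₚ h) (map-⟨⟩ (fromMaybe false) hu he ha hc) (fromMaybe-∈ₚ h)

    he≡allStar : he ≡ allStar k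
    he≡allStar = ∈ₚ-complement⇒allStar (proj₁ (proj₂ (∈ₚ-⟨⟩⁻ some-point))) (proj₁ (proj₂ (∈ₚ-⟨⟩⁻ (step some-point))))

    reshape : ∀ e′ → u ≡ u′ → a ≡ a′ → c ≡ c′ → ⟨ u ∣ e ∣ a ∣ c ⟩ ∈ₚ h → ⟨ u′ ∣ e′ ∣ a′ ∣ c′ ⟩ ∈ₚ h
    reshape e′ refl refl refl x∈h with ∈ₚ-⟨⟩⁻ x∈h
    ... | u∈ , _ , a∈ , c∈ = ∈ₚ-⟨⟩⁺ u∈ (subst (e′ ∈ₚ_) (sym he≡allStar) (∈ₚ-allStar e′)) a∈ c∈

    Contains : Bool → Bool → Set
    Contains a c = ∃ λ (u : Vec Bool n₁) → ∀ (e : Vec Bool k) → ⟨ u ∣ e ∣ a ∣ c ⟩ ∈ₚ h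

    resting-point : Contains false false
    resting-point = settle _ _ some-point
      where
      settle-after-c : ∀ a → ⟨ u ∣ e ∣ a ∣ true ⟩ ∈ₚ h → Contains false false
      settle-after-c a x∈h = _ , λ e → reshape e refl (∧-zeroʳ _) (∧-zeroʳ a) (step x∈h)
      settle : ∀ a c → ⟨ u ∣ e ∣ a ∣ c ⟩ ∈ₚ h → Contains false false
      settle false false x∈h = _ , λ e → reshape e refl refl refl x∈h
      settle a     true  x∈h = settle-after-c a x∈h
      settle true  false x∈h = settle-after-c _ (step x∈h)

    excited-point : Contains true false
    excited-point with resting-point
    ... | u , resting with solvable u
    ...   | y₂ , sat = _ , λ e → reshape e refl (trans (∧-identityʳ _) sat) refl (step (resting y₂))

    flipping-point : ∀ e → ⟨ replicate n₁ false ∣ e ∣ true ∣ true ⟩ ∈ₚ h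
    flipping-point e with excited-point
    ... | u , excited with solvable u
    ...   | y₂ , sat = reshape e (trans (map-cong (λ b → trans (∨-identityʳ _) (∧-zeroʳ b)) u) (map-const u false))
                                 (trans (∧-identityʳ _) sat) refl (step (excited y₂))

    trivial : h ≡ allStar (n₁ + k + 2)
    trivial = ∈ₚ-complement⇒allStar x∈h (subst (_∈ₚ h) (netF-flips _) (trap _ x∈h))
      where x∈h = flipping-point (replicate k false)

  module Unsolvable (y₁ : Vec Bool n₁) (unsolvable : ∀ (y₂ : Vec Bool k) → ⟦ φ ⟧ (y₁ ++ y₂) ≡ false) where

    h : SubHypercube (n₁ + k + 2)
    h = ⟨ map just y₁ ∣ allStar k ∣ just false ∣ just false ⟩

    trap : ∀ x → x ∈ₚ h → netF n₁ (n₁ + k) φ x ∈ₚ h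
    trap x x∈h with blocks {n₁ = n₁} {k = k} x
    ... | ⟨ u ∣ e ∣ a ∣ c ⟩ᵇ with ∈ₚ-⟨⟩⁻ x∈h
    ...   | u∈ , _ , a∈ , c∈ =
      subst (_∈ₚ h) (sym (netF-⟨⟩ u e a c)) (at-rest (∈ₚ-map-just⁻ u∈) (a∈ false refl) (c∈ false refl))
      where
      at-rest : u ≡ y₁ → a ≡ false → c ≡ false →
                ⟨ map (λ b → (b ∧ not a) ∨ c) u ∣ map not e ∣ ⟦ φ ⟧ (u ++ e) ∧ not c ∣ a ∧ not c ⟩ ∈ₚ h
      at-rest refl refl refl =
        ∈ₚ-⟨⟩⁺ (subst (_∈ₚ map just u) (sym (trans (map-cong (λ b → trans (∨-identityʳ _) (∧-identityʳ b)) u) (map-id u)))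
                      (∈ₚ-map-just u))
               (∈ₚ-allStar _) (∈₁-just (trans (∧-identityʳ _) (unsolvable e))) (∈₁-just refl)

    nontrivial : h ≢ allStar (n₁ + k + 2)
    nontrivial h≡* with ∈ₚ-⟨⟩⁻ (subst (⟨ y₁ ∣ replicate k false ∣ true ∣ false ⟩ ∈ₚ_) (sym h≡*) (∈ₚ-allStar _))
    ... | _ , _ , a∈ , _ with a∈ false refl
    ... | ()

  criterion : ForallExists ⇔ UniqueTrapSpace (netF n₁ (n₁ + k) φ) (allStar (n₁ + k + 2))
  criterion = mk⇔ forward backward
    where
    forward : ForallExists → UniqueTrapSpace (netF n₁ (n₁ + k) φ) (allStar (n₁ + k + 2))
    forward solvable = allStar-isTrapSpace (netF n₁ (n₁ + k) φ) , only
      where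
      only : ∀ h → IsTrapSpace (netF n₁ (n₁ + k) φ) h → h ≡ allStar (n₁ + k + 2)
      only h trap with blocks {n₁ = n₁} {k = k} h
      ... | ⟨ _ ∣ _ ∣ _ ∣ _ ⟩ᵇ = Solvable.trivial solvable (to isTrapSpace⇔ trap)
    backward : UniqueTrapSpace (netF n₁ (n₁ + k) φ) (allStar (n₁ + k + 2)) → ForallExists
    backward (_ , only) y₁ with ∃-Vec-Bool? (λ y₂ → ⟦ φ ⟧ (y₁ ++ y₂) ≟ true)
    ... | yes sat = sat
    ... | no ¬sat = ⊥-elim (Unsolvable.nontrivial y₁ unsat (only _ (from isTrapSpace⇔ (Unsolvable.trap y₁ unsat))))
      where
      unsat : ∀ y₂ → ⟦ φ ⟧ (y₁ ++ y₂) ≡ false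
      unsat y₂ = ¬-not (λ eq → ¬sat (y₂ , eq))

criterion-subst : ∀ {n₁ k n₂} (eq : n₁ + k ≡ n₂) (φ : Formula n₂) →
  ((y₁ : Vec Bool n₁) → ∃ λ (y₂ : Vec Bool k) → ⟦ φ ⟧ (subst (Vec Bool) eq (y₁ ++ y₂)) ≡ true)
  ⇔ UniqueTrapSpace (netF n₁ n₂ φ) (allStar (n₂ + 2))
criterion-subst refl φ = criterion φ

lemma1 : (n₁ n₂ : ℕ) (le : n₁ ≤ n₂) (φ : Formula n₂) →
    ((y₁ : Vec Bool n₁) → ∃ λ (y₂ : Vec Bool (n₂ ∸ n₁)) →
        ⟦ φ ⟧ (subst (Vec Bool) (m+[n∸m]≡n le) (y₁ ++ y₂)) ≡ true)
    ⇔ UniqueTrapSpace (netF n₁ n₂ φ) (allStar (n₂ Data.Nat.+ 2))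
lemma1 n₁ n₂ le φ = criterion-subst (m+[n∸m]≡n le) φ
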